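{- Let $R$ be a finite chain ring of nilpotency index $m$ with maximal ideal $N$ and residue field $R/N\cong\mathbb{F}_q$, and let $n\ge 3$. Let $\mathcal{F}=\{F_1,\dots,F_M\}$ be a $\tau$-intersecting family of subspaces of shape $\kappa$ in $\mathrm{PHG}(n-1,R)$, where \[\kappa=m^{k_m}(m-1)^{k_{m-1}}\cdots 1^{k_1},\qquad \tau=m^{t_m}(m-1)^{t_{m-1}}\cdots 1^{t_1}.\] Then for every $i\in\{1,\dots,m-1\}$ the family $\eta_i(\mathcal{F})=\{\eta_i(F_1),\dots,\eta_i(F_M)\}$ is a $\tau'$-intersecting family of subspaces of shape $\kappa'$ in $\mathrm{PHG}(n-1,R/N^i)$, where \[\kappa'=i^{k_m}(i-1)^{k_{m-1}}\cdots 1^{k_{m-i+1}},\qquad \tau'=i^{t_m}(i-1)^{t_{m-1}}\cdots 1^{t_{m-i+1}}.\] In particular, $\eta_1(\mathcal{F})$ is a family of $(k_m-1)$-dimensional projective subspaces of $\mathrm{PG}(n-1,q)$ any two of which meet in a projective subspace of dimension at least $t_m-1$.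
   Context: A finite chain ring is a finite ring $R$ with identity whose left ideals are totally ordered by inclusion; its ideals are $R>N>N^2>\dots>N^{m-1}>N^m=0$, where $N$ is the unique maximal ideal and $m$ is the nilpotency index; $R/N\cong\mathbb{F}_q$ and $|R|=q^m$. Every finite left $R$-module is isomorphic to a direct sum $\bigoplus_j R/N^{\lambda_j}$ with $m\ge\lambda_1\ge\lambda_2\ge\dots\ge 1$, uniquely determined; its shape is written $m^{a_m}(m-1)^{a_{m-1}}\cdots 1^{a_1}$, where $a_i$ is the number of $j$ with $\lambda_j=i$. A module of shape $m^s$ is free of rank $s$. The projective Hjelmslev geometry $\mathrm{PHG}(n-1,R)$ has as points the free rank-1 submodules of the left module $R^n$; to each submodule $U\le R^n$ (containing at least one point) is associated the subspace consisting of all points contained in $U$, and the shape of the subspace is the shape of $U$. A subspace associated with a free submodule of rank $s$ is called a Hjelmslev subspace of (projective) dimension $s-1$. Two subspaces meet in the subspace associated with the intersection of their submodules. For $1\le i\le m-1$, $\eta_i:R\to R/N^i$ is the natural homomorphism, applied coordinatewise to $R^n$; for a subspace $F$ with submodule $U$, $\eta_i(F)$ is the subspace of $\mathrm{PHG}(n-1,R/N^i)$ associated with $\eta_i(U)$ (note $R/N^i$ is a chain ring of nilpotency index $i$, and $R/N\cong\mathbb{F}_q$, so $\mathrm{PHG}(n-1,R/N)=\mathrm{PG}(n-1,q)$). A family $\mathcal{F}$ of subspaces of a fixed shape $\kappa$ is called $\tau$-intersecting if every two distinct members of $\mathcal{F}$ meet in a subspace containing a subspace of shape $\tau$. -}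

module Defs where

open import Level using (Level; _⊔_; Lift)
open import Algebra.Bundles using (Ring)
open import Data.Nat using (ℕ; zero; suc; _≤_; _<_; _≟_)
open import Data.Fin using (Fin)
open import Data.List using (List; []; _∷_; length; lookup)
open import Data.List.Relation.Unary.All using (All)
open import Data.Product using (Σ; ∃; ∃-syntax; Σ-syntax; _×_; _,_)
open import Data.Sum using (_⊎_)
open import Data.Unit using (⊤)
open import Relation.Nullary using (¬_; yes; no)
open import Relation.Unary using (Pred; _⊆_)
open import Relation.Binary.PropositionalEquality using (_≡_)

countPart : ℕ → List ℕ → ℕ
countPart j [] = 0
countPart j (x ∷ xs) with j ≟ x
... | yes _ = suc (countPart j xs)
... | no  _ = countPart j xs

Vector : ∀ {a} → Set a → ℕ → Set a
Vector A n = Fin n → A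

module PHG {c ℓ : Level} (R : Ring c ℓ) where
  open Ring R

  Ideal-level : Level
  Ideal-level = c ⊔ ℓ

  Finite : Set (c ⊔ ℓ)
  Finite = Σ[ k ∈ ℕ ] Σ[ e ∈ (Fin k → Carrier) ] (∀ x → ∃[ j ] e j ≈ x)

  record IsLeftIdeal (I : Pred Carrier (c ⊔ ℓ)) : Set (c ⊔ ℓ) where
    field
      resp : ∀ {x y} → x ≈ y → I x → I y
      zer  : I 0#
      add  : ∀ {x y} → I x → I y → I (x + y)
      lmul : ∀ r {x} → I x → I (r * x)

  IsChainRing : Set (Level.suc (c ⊔ ℓ))
  IsChainRing = (¬ (1# ≈ 0#)) ×
    (∀ (I J : Pred Carrier (c ⊔ ℓ)) → IsLeftIdeal I → IsLeftIdeal J → (I ⊆ J) ⊎ (J ⊆ I))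

  IsMaximalLeftIdeal : Pred Carrier (c ⊔ ℓ) → Set (Level.suc (c ⊔ ℓ))
  IsMaximalLeftIdeal N = IsLeftIdeal N × (¬ N 1#) ×
    (∀ (I : Pred Carrier (c ⊔ ℓ)) → IsLeftIdeal I → N ⊆ I → (I ⊆ N) ⊎ I 1#)

  data AddClos (P : Pred Carrier (c ⊔ ℓ)) : Pred Carrier (c ⊔ ℓ) where
    ac-gen : ∀ {x} → P x → AddClos P x
    ac-zer : ∀ {x} → x ≈ 0# → AddClos P x
    ac-add : ∀ {x y z} → AddClos P y → AddClos P z → x ≈ y + z → AddClos P x

  module WithN (N : Pred Carrier (c ⊔ ℓ)) where

    NPow : ℕ → Pred Carrier (c ⊔ ℓ)
    NPow zero    _ = Lift (c ⊔ ℓ) ⊤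
    NPow (suc k)   = AddClos (λ x → Σ[ a ∈ Carrier ] Σ[ b ∈ Carrier ]
                                       (N a × NPow k b × x ≈ a * b))

    IsZeroIdeal : Pred Carrier (c ⊔ ℓ) → Set (c ⊔ ℓ)
    IsZeroIdeal I = ∀ x → I x → x ≈ 0#

    NilpotencyIndex : ℕ → Set (c ⊔ ℓ)
    NilpotencyIndex m = IsZeroIdeal (NPow m) × (∀ k → k < m → ¬ IsZeroIdeal (NPow k))

    -- congruence modulo N^i (the ring R/N^i)
    _≡[_]_ : Carrier → ℕ → Carrier → Set (c ⊔ ℓ)
    x ≡[ i ] y = NPow i (x - y)

    module _ {n : ℕ} where
      _+ᵥ_ : Vector Carrier n → Vector Carrier n → Vector Carrier n
      (v +ᵥ w) j = v j + w j

      _·ᵥ_ : Carrier → Vector Carrier n → Vector Carrier n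
      (r ·ᵥ v) j = r * v j

      0ᵥ : Vector Carrier n
      0ᵥ j = 0#

      _≈ᵥ_ : Vector Carrier n → Vector Carrier n → Set ℓ
      v ≈ᵥ w = ∀ j → v j ≈ w j

      _≡ᵥ[_]_ : Vector Carrier n → ℕ → Vector Carrier n → Set (c ⊔ ℓ)
      v ≡ᵥ[ i ] w = ∀ j → v j ≡[ i ] w j

    record IsSubmodule {n : ℕ} (U : Pred (Vector Carrier n) (c ⊔ ℓ)) : Set (c ⊔ ℓ) where
      field
        resp : ∀ {v w} → v ≈ᵥ w → U v → U w
        zer  : U 0ᵥ
        add  : ∀ {v w} → U v → U w → U (v +ᵥ w)
        smul : ∀ r {v} → U v → U (r ·ᵥ v)

    -- Submodules of (R/N^i)^n are represented by R-submodules U of R^n, via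
    -- their image mod N^i.  For i = m (N^m = 0) this is U itself.

    -- eta_i(U) : the image of U under R^n -> (R/N^i)^n (as its full preimage)
    η : ℕ → ∀ {n} → Pred (Vector Carrier n) (c ⊔ ℓ) → Pred (Vector Carrier n) (c ⊔ ℓ)
    η i U v = Σ[ u ∈ Vector Carrier _ ] (U u × v ≡ᵥ[ i ] u)

    SubsetAt : ℕ → ∀ {n} → Pred (Vector Carrier n) (c ⊔ ℓ) → Pred (Vector Carrier n) (c ⊔ ℓ) → Set (c ⊔ ℓ)
    SubsetAt i {n} U V = ∀ v → U v → Σ[ w ∈ Vector Carrier n ] (V w × v ≡ᵥ[ i ] w)

    SameAt : ℕ → ∀ {n} → Pred (Vector Carrier n) (c ⊔ ℓ) → Pred (Vector Carrier n) (c ⊔ ℓ) → Set (c ⊔ ℓ)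
    SameAt i U V = SubsetAt i U V × SubsetAt i V U

    -- the standard module  ⊕_j R/N^{λ_j}
    Model : List ℕ → Set c
    Model λs = Fin (length λs) → Carrier

    ModelEq : (λs : List ℕ) → Model λs → Model λs → Set (c ⊔ ℓ)
    ModelEq λs x y = ∀ j → x j ≡[ lookup λs j ] y j

    record IsIsoAt (i : ℕ) {n : ℕ} (λs : List ℕ) (U : Pred (Vector Carrier n) (c ⊔ ℓ))
                   (f : Model λs → Vector Carrier n) : Set (c ⊔ ℓ) where
      field
        resp : ∀ x y → ModelEq λs x y → f x ≡ᵥ[ i ] f y
        into : ∀ x → U (f x)
        add  : ∀ x y → f (λ j → x j + y j) ≡ᵥ[ i ] (f x +ᵥ f y)
        smul : ∀ r x → f (λ j → r * x j) ≡ᵥ[ i ] (r ·ᵥ f x)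
        inj  : ∀ x y → f x ≡ᵥ[ i ] f y → ModelEq λs x y
        surj : ∀ v → U v → Σ[ x ∈ Model λs ] (f x ≡ᵥ[ i ] v)

    HasPartsAt : ℕ → ∀ {n} → Pred (Vector Carrier n) (c ⊔ ℓ) → List ℕ → Set (c ⊔ ℓ)
    HasPartsAt i {n} U λs = All (λ l → 1 ≤ l × l ≤ i) λs ×
      Σ[ f ∈ (Model λs → Vector Carrier n) ] IsIsoAt i λs U f

    -- shape  i^{a i} (i-1)^{a (i-1)} ... 1^{a 1}  (a j = multiplicity of part j)
    HasShapeAt : ℕ → ∀ {n} → Pred (Vector Carrier n) (c ⊔ ℓ) → (ℕ → ℕ) → Set (c ⊔ ℓ)
    HasShapeAt i U a = Σ[ λs ∈ List ℕ ]
      (HasPartsAt i U λs × (∀ j → 1 ≤ j → j ≤ i → countPart j λs ≡ a j))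

    -- contains a point of PHG(n-1, R/N^i): a free rank-1 submodule (shape i^1)
    ContainsPointAt : ℕ → ∀ {n} → Pred (Vector Carrier n) (c ⊔ ℓ) → Set (Level.suc (c ⊔ ℓ))
    ContainsPointAt i {n} U = Σ[ P ∈ Pred (Vector Carrier n) (c ⊔ ℓ) ]
      (IsSubmodule P × HasPartsAt i P (i ∷ []) × SubsetAt i P U)

    IsSubspaceOfShapeAt : ℕ → ∀ {n} → Pred (Vector Carrier n) (c ⊔ ℓ) → (ℕ → ℕ) → Set (Level.suc (c ⊔ ℓ))
    IsSubspaceOfShapeAt i U a = HasShapeAt i U a × ContainsPointAt i U

    MeetsInShapeAt : ℕ → ∀ {n} → (ℕ → ℕ) → Pred (Vector Carrier n) (c ⊔ ℓ) → Pred (Vector Carrier n) (c ⊔ ℓ) → Set (Level.suc (c ⊔ ℓ))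
    MeetsInShapeAt i {n} τ U V = Σ[ W ∈ Pred (Vector Carrier n) (c ⊔ ℓ) ]
      (IsSubmodule W × IsSubspaceOfShapeAt i W τ × SubsetAt i W U × SubsetAt i W V)

    IsIntersectingAt : ℕ → ∀ {n M} → (ℕ → ℕ) → (Fin M → Pred (Vector Carrier n) (c ⊔ ℓ)) → Set (Level.suc (c ⊔ ℓ))
    IsIntersectingAt i τ F = ∀ a b → ¬ SameAt i (F a) (F b) → MeetsInShapeAt i τ (F a) (F b)

-- A finite chain ring has a principal maximal ideal N = Rθ with θR = Rθ, so N^k = Rθ^k.  Since
-- θ^j ∉ N^(j+1) for j < m (Nakayama), every element is a unit times a power of θ modulo N^d, and
-- multiplication by θ^s turns congruence modulo N^(a-s) into congruence modulo N^a and back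
-- (a ≤ m).  Hence if U ≅ ⊕ R/N^λⱼ, then, with s = m - i, U modulo N^i is ⊕ R/N^(λⱼ-s) over the
-- parts λⱼ > s (pad the dropped summands with zeros): the parts m, ..., m-i+1 become i, ..., 1.
-- Points stay points and inclusions survive reduction, so shapes and intersections pass to the
-- images η_i.

module Submission where

open import Defs

open import Level using (Level; _⊔_; lift)
open import Algebra.Bundles using (Ring)
import Algebra.Properties.Ring as RingProperties
import Algebra.Properties.Semiring.Exp as SemiringExponentiation
open import Data.Nat as ℕ using (ℕ; zero; suc; _∸_; _≤_; _<_; _≟_; z≤n; s≤s)
import Data.Nat.Properties as ℕₚ
open import Data.Nat.Properties using (_<?_)
open import Data.Fin using (Fin) renaming (zero to fzero; suc to fsuc)
open import Data.List using (List; []; _∷_; length; lookup)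
open import Data.List.Relation.Unary.All as All using (All; []; _∷_)
open import Data.List.Membership.Propositional.Properties using (∈-lookup)
open import Data.Product using (Σ-syntax; _×_; _,_; proj₁; proj₂)
open import Data.Sum using (_⊎_; inj₁; inj₂)
open import Data.Unit using (tt)
open import Function using (_∘_)
open import Relation.Nullary using (¬_; yes; no; contradiction)
open import Relation.Unary using (Pred; _⊆_)
open import Relation.Binary.PropositionalEquality as ≡ using (_≡_)
open import Relation.Binary.Structures using (IsEquivalence)
import Data.Vec.Functional.Relation.Binary.Pointwise.Properties as Pointwise
import Relation.Binary.Reasoning.Setoid as SetoidReasoning

lowerParts : ℕ → List ℕ → List ℕ
lowerParts s [] = []
lowerParts s (l ∷ ls) with s <? l
... | yes _ = l ∸ s ∷ lowerParts s ls
... | no  _ = lowerParts s ls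

countPart-lowerParts : ∀ s ls {j} → 1 ≤ j → countPart j (lowerParts s ls) ≡ countPart (s ℕ.+ j) ls
countPart-lowerParts s [] 1≤j = ≡.refl
countPart-lowerParts s (l ∷ ls) {j} 1≤j with s <? l
... | yes s<l with j ≟ l ∸ s | s ℕ.+ j ≟ l
...   | yes _   | yes _    = ≡.cong suc (countPart-lowerParts s ls 1≤j)
...   | no  _   | no  _    = countPart-lowerParts s ls 1≤j
...   | yes j≡l∸s | no s+j≢l = contradiction (≡.trans (≡.cong (s ℕ.+_) j≡l∸s) (ℕₚ.m+[n∸m]≡n (ℕₚ.<⇒≤ s<l))) s+j≢l
...   | no j≢l∸s  | yes s+j≡l = contradiction (≡.trans (≡.sym (ℕₚ.m+n∸m≡n s j)) (≡.cong (_∸ s) s+j≡l)) j≢l∸s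
countPart-lowerParts s (l ∷ ls) {j} 1≤j | no s≮l with s ℕ.+ j ≟ l
... | yes s+j≡l = contradiction (ℕₚ.<-≤-trans (ℕₚ.m<m+n s 1≤j) (ℕₚ.≤-reflexive s+j≡l)) s≮l
... | no  _     = countPart-lowerParts s ls 1≤j

lowerParts-bounded : ∀ s {k} ls → All (λ l → 1 ≤ l × l ≤ k) ls → All (λ l → 1 ≤ l × l ≤ k ∸ s) (lowerParts s ls)
lowerParts-bounded s [] [] = []
lowerParts-bounded s (l ∷ ls) ((_ , l≤k) ∷ bounds) with s <? l
... | yes s<l = (ℕₚ.m<n⇒0<n∸m s<l , ℕₚ.∸-monoˡ-≤ s l≤k) ∷ lowerParts-bounded s ls bounds
... | no  _   = lowerParts-bounded s ls bounds

lowerParts-singleton : ∀ {i k} → 1 ≤ i → i ≤ k → lowerParts (k ∸ i) (k ∷ []) ≡ i ∷ []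
lowerParts-singleton {i} {k} 1≤i i≤k with k ∸ i <? k
... | yes _     = ≡.cong (_∷ []) (ℕₚ.m∸[m∸n]≡n i≤k)
... | no  k∸i≮k = contradiction (ℕₚ.∸-monoʳ-< 1≤i i≤k) k∸i≮k

module _ {a} {A : Set a} (z : A) where

  pad : ∀ s ls → (Fin (length (lowerParts s ls)) → A) → Fin (length ls) → A
  pad s (l ∷ ls) x j with s <? l
  pad s (l ∷ ls) x fzero    | yes _ = x fzero
  pad s (l ∷ ls) x (fsuc j) | yes _ = pad s ls (x ∘ fsuc) j
  pad s (l ∷ ls) x fzero    | no  _ = z
  pad s (l ∷ ls) x (fsuc j) | no  _ = pad s ls x j

  restrict : ∀ s ls → (Fin (length ls) → A) → Fin (length (lowerParts s ls)) → A
  restrict s (l ∷ ls) y with s <? l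
  ... | yes _ = λ { fzero → y fzero ; (fsuc j) → restrict s ls (y ∘ fsuc) j }
  ... | no  _ = restrict s ls (y ∘ fsuc)

  dropped⊎survives : ∀ s ls j →
    (lookup ls j ≤ s × (∀ x → pad s ls x j ≡ z)) ⊎
    (Σ[ j' ∈ Fin (length (lowerParts s ls)) ] lookup (lowerParts s ls) j' ≡ lookup ls j ∸ s ×
       (∀ x → pad s ls x j ≡ x j') × (∀ y → restrict s ls y j' ≡ y j))
  dropped⊎survives s (l ∷ ls) j with s <? l
  dropped⊎survives s (l ∷ ls) fzero    | yes _ = inj₂ (fzero , ≡.refl , (λ _ → ≡.refl) , (λ _ → ≡.refl))
  dropped⊎survives s (l ∷ ls) (fsuc j) | yes _ with dropped⊎survives s ls j
  ... | inj₁ (l≤s , pad≡z) = inj₁ (l≤s , pad≡z ∘ (_∘ fsuc))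
  ... | inj₂ (j' , l≡ , pad≡ , restrict≡) = inj₂ (fsuc j' , l≡ , pad≡ ∘ (_∘ fsuc) , restrict≡ ∘ (_∘ fsuc))
  dropped⊎survives s (l ∷ ls) fzero    | no s≮l = inj₁ (ℕₚ.≮⇒≥ s≮l , λ _ → ≡.refl)
  dropped⊎survives s (l ∷ ls) (fsuc j) | no _ with dropped⊎survives s ls j
  ... | inj₁ dropped = inj₁ dropped
  ... | inj₂ (j' , l≡ , pad≡ , restrict≡) = inj₂ (j' , l≡ , pad≡ , restrict≡ ∘ (_∘ fsuc))

  origin : ∀ s ls (j' : Fin (length (lowerParts s ls))) →
           Σ[ j ∈ Fin (length ls) ] (lookup (lowerParts s ls) j' ≡ lookup ls j ∸ s × (∀ x → pad s ls x j ≡ x j'))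
  origin s (l ∷ ls) j' with s <? l
  origin s (l ∷ ls) fzero     | yes _ = fzero , ≡.refl , λ _ → ≡.refl
  origin s (l ∷ ls) (fsuc j') | yes _ with origin s ls j'
  ... | j , l≡ , pad≡ = fsuc j , l≡ , pad≡ ∘ (_∘ fsuc)
  origin s (l ∷ ls) j'        | no  _ with origin s ls j'
  ... | j , l≡ , pad≡ = fsuc j , l≡ , pad≡

m<n∸o⇒o+m<n : ∀ o {m n} → m < n ∸ o → o ℕ.+ m < n
m<n∸o⇒o+m<n zero            m<n   = m<n
m<n∸o⇒o+m<n (suc o) {n = suc n} m<n∸o = s≤s (m<n∸o⇒o+m<n o m<n∸o)

module CongruenceModulo {c ℓ} (R : Ring c ℓ) {I : Pred (Ring.Carrier R) (c ⊔ ℓ)}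
                        (I-ideal : PHG.IsLeftIdeal R I) where
  open Ring R
  open RingProperties R
  open PHG.IsLeftIdeal I-ideal
  open SetoidReasoning setoid

  _≋_ : Carrier → Carrier → Set (c ⊔ ℓ)
  x ≋ y = I (x - y)

  ≈⇒≋ : ∀ {x y} → x ≈ y → x ≋ y
  ≈⇒≋ x≈y = resp (sym (x≈y⇒x∙y⁻¹≈ε x≈y)) zer

  ≋-isEquivalence : IsEquivalence _≋_
  ≋-isEquivalence = record
    { refl  = ≈⇒≋ refl
    ; sym   = λ {x y} x≋y → resp (trans (-1*x≈-x (x - y)) (⁻¹-anti-homo‿- x y)) (lmul (- 1#) x≋y)
    ; trans = λ {x y z} x≋y y≋z → resp (telescope x y z) (add x≋y y≋z)
    }
    where
    telescope : ∀ x y z → (x - y) + (y - z) ≈ x - z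
    telescope x y z = begin
      (x - y) + (y - z)   ≈⟨ +-assoc x (- y) (y - z) ⟩
      x + (- y + (y - z)) ≈⟨ +-congˡ (+-assoc (- y) y (- z)) ⟨
      x + ((- y + y) - z) ≈⟨ +-congˡ (+-congʳ (-‿inverseˡ y)) ⟩
      x + (0# - z)        ≈⟨ +-congˡ (+-identityˡ (- z)) ⟩
      x - z               ∎

module IdealPowers {c ℓ} (R : Ring c ℓ) (N : Pred (Ring.Carrier R) (c ⊔ ℓ))
                   (N-ideal : PHG.IsLeftIdeal R N) where
  open Ring R
  open PHG R
  open WithN N

  NPow-isLeftIdeal : ∀ k → IsLeftIdeal (NPow k)
  NPow-isLeftIdeal zero = record
    { resp = λ _ _ → lift tt ; zer = lift tt ; add = λ _ _ → lift tt ; lmul = λ _ _ → lift tt }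
  NPow-isLeftIdeal (suc k) = record
    { resp = λ x≈y x∈ → ac-add x∈ (ac-zer refl) (trans (sym x≈y) (sym (+-identityʳ _)))
    ; zer  = ac-zer refl
    ; add  = λ x∈ y∈ → ac-add x∈ y∈ refl
    ; lmul = lmul
    }
    where
    lmul : ∀ r {x} → NPow (suc k) x → NPow (suc k) (r * x)
    lmul r (ac-gen (a , b , a∈N , b∈ , x≈ab)) =
      ac-gen (r * a , b , IsLeftIdeal.lmul N-ideal r a∈N , b∈ , trans (*-congˡ x≈ab) (sym (*-assoc r a b)))
    lmul r (ac-zer x≈0) = ac-zer (trans (*-congˡ x≈0) (zeroʳ r))
    lmul r (ac-add y∈ z∈ x≈y+z) = ac-add (lmul r y∈) (lmul r z∈) (trans (*-congˡ x≈y+z) (distribˡ r _ _))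

  module NPow-ideal (k : ℕ) = IsLeftIdeal (NPow-isLeftIdeal k)

  NPow-suc⊆ : ∀ k → NPow (suc k) ⊆ NPow k
  NPow-suc⊆ k (ac-gen (a , b , _ , b∈ , x≈ab)) = NPow-ideal.resp k (sym x≈ab) (NPow-ideal.lmul k a b∈)
  NPow-suc⊆ k (ac-zer x≈0) = NPow-ideal.resp k (sym x≈0) (NPow-ideal.zer k)
  NPow-suc⊆ k (ac-add y∈ z∈ x≈y+z) =
    NPow-ideal.resp k (sym x≈y+z) (NPow-ideal.add k (NPow-suc⊆ k y∈) (NPow-suc⊆ k z∈))

  NPow-antitone : ∀ {j k} → j ≤ k → NPow k ⊆ NPow j
  NPow-antitone {k = zero}  z≤n x∈ = x∈
  NPow-antitone {k = suc k} j≤1+k x∈ with ℕₚ.m≤n⇒m<n∨m≡n j≤1+k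
  ... | inj₁ (s≤s j≤k) = NPow-antitone j≤k (NPow-suc⊆ k x∈)
  ... | inj₂ ≡.refl    = x∈

  ≈⇒≡[] : ∀ k {x y} → x ≈ y → x ≡[ k ] y
  ≈⇒≡[] k = CongruenceModulo.≈⇒≋ R (NPow-isLeftIdeal k)

  ≡[]-isEquivalence : ∀ k → IsEquivalence _≡[ k ]_
  ≡[]-isEquivalence k = CongruenceModulo.≋-isEquivalence R (NPow-isLeftIdeal k)

  ≡ᵥ[]-isEquivalence : ∀ k n → IsEquivalence {A = Vector Carrier n} _≡ᵥ[ k ]_
  ≡ᵥ[]-isEquivalence k = Pointwise.isEquivalence (≡[]-isEquivalence k)

  module ≡ᵥ (k : ℕ) {n : ℕ} = IsEquivalence (≡ᵥ[]-isEquivalence k n)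

  ≡ᵥ[]-antitone : ∀ {j k n} {v w : Vector Carrier n} → j ≤ k → v ≡ᵥ[ k ] w → v ≡ᵥ[ j ] w
  ≡ᵥ[]-antitone j≤k v≡w t = NPow-antitone j≤k (v≡w t)

  module _ {n : ℕ} {X Y : Pred (Vector Carrier n) (c ⊔ ℓ)} where

    SubsetAt-antitone : ∀ {i k} → i ≤ k → SubsetAt k X Y → SubsetAt i X Y
    SubsetAt-antitone i≤k X⊆Y v v∈X with X⊆Y v v∈X
    ... | w , w∈Y , v≡w = w , w∈Y , ≡ᵥ[]-antitone i≤k v≡w

    SubsetAt-η : ∀ {i} → SubsetAt i X Y → SubsetAt i X (η i Y)
    SubsetAt-η {i} X⊆Y v v∈X with X⊆Y v v∈X
    ... | w , w∈Y , v≡w = w , (w , w∈Y , ≡ᵥ.refl i) , v≡w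

    SubsetAt⇒η-SubsetAt : ∀ {i k} → i ≤ k → SubsetAt k X Y → SubsetAt i (η i X) (η i Y)
    SubsetAt⇒η-SubsetAt {i} i≤k X⊆Y v (u , u∈X , v≡u) with X⊆Y u u∈X
    ... | w , w∈Y , u≡w = v , (w , w∈Y , ≡ᵥ.trans i v≡u (≡ᵥ[]-antitone i≤k u≡w)) , ≡ᵥ.refl i

  SameAt⇒η-SameAt : ∀ {i k n} {X Y : Pred (Vector Carrier n) (c ⊔ ℓ)} → i ≤ k →
                    SameAt k X Y → SameAt i (η i X) (η i Y)
  SameAt⇒η-SameAt i≤k (X⊆Y , Y⊆X) = SubsetAt⇒η-SubsetAt i≤k X⊆Y , SubsetAt⇒η-SubsetAt i≤k Y⊆X

  HasPartsAt-η : ∀ {i n} {U : Pred (Vector Carrier n) (c ⊔ ℓ)} {ls} → HasPartsAt i U ls → HasPartsAt i (η i U) ls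
  HasPartsAt-η {i} (bounded , f , iso) = bounded , f , record
    { resp = Iso.resp
    ; into = λ x → f x , Iso.into x , ≡ᵥ.refl i
    ; add  = Iso.add
    ; smul = Iso.smul
    ; inj  = Iso.inj
    ; surj = λ { v (u , u∈U , v≡u) → let x , fx≡u = Iso.surj u u∈U in x , ≡ᵥ.trans i fx≡u (≡ᵥ.sym i v≡u) }
    }
    where module Iso = IsIsoAt iso

  IsSubspaceOfShapeAt-η : ∀ {i n} {U : Pred (Vector Carrier n) (c ⊔ ℓ)} {a} →
                          IsSubspaceOfShapeAt i U a → IsSubspaceOfShapeAt i (η i U) a
  IsSubspaceOfShapeAt-η ((ls , parts , counts) , (P , P-submodule , P-point , P⊆U)) =
    (ls , HasPartsAt-η parts , counts) , (P , P-submodule , P-point , SubsetAt-η P⊆U)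

  MeetsInShapeAt-η : ∀ {i n} {U V : Pred (Vector Carrier n) (c ⊔ ℓ)} {τ} →
                     MeetsInShapeAt i τ U V → MeetsInShapeAt i τ (η i U) (η i V)
  MeetsInShapeAt-η (W , W-submodule , W-subspace , W⊆U , W⊆V) =
    W , W-submodule , W-subspace , SubsetAt-η W⊆U , SubsetAt-η W⊆V

module ChainRing {c ℓ} (R : Ring c ℓ) (chain : PHG.IsChainRing R)
                 (N : Pred (Ring.Carrier R) (c ⊔ ℓ)) (N-maximal : PHG.IsMaximalLeftIdeal R N) where
  open Ring R
  open RingProperties R
  open PHG R
  open WithN N
  open SetoidReasoning setoid

  N-isLeftIdeal : IsLeftIdeal N
  N-isLeftIdeal = proj₁ N-maximal

  open IdealPowers R N N-isLeftIdeal public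
  private module N-ideal = IsLeftIdeal N-isLeftIdeal

  1∉N : ¬ N 1#
  1∉N = proj₁ (proj₂ N-maximal)

  principal : Carrier → Pred Carrier (c ⊔ ℓ)
  principal x y = Σ[ r ∈ Carrier ] y ≈ r * x

  principal-isLeftIdeal : ∀ x → IsLeftIdeal (principal x)
  principal-isLeftIdeal x = record
    { resp = λ { y≈z (r , y≈rx) → r , trans (sym y≈z) y≈rx }
    ; zer  = 0# , sym (zeroˡ x)
    ; add  = λ { (r , y≈rx) (t , z≈tx) → r + t , trans (+-cong y≈rx z≈tx) (sym (distribʳ x r t)) }
    ; lmul = λ { t (r , y≈rx) → t * r , trans (*-congˡ y≈rx) (sym (*-assoc t r x)) }
    }

  x∈principal : ∀ x → principal x x
  x∈principal x = 1# , sym (*-identityˡ x)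

  LeftInvertible : Carrier → Set (c ⊔ ℓ)
  LeftInvertible x = Σ[ y ∈ Carrier ] y * x ≈ 1#

  ∈N⊎leftInvertible : ∀ x → N x ⊎ LeftInvertible x
  ∈N⊎leftInvertible x with proj₂ chain (principal x) N (principal-isLeftIdeal x) N-isLeftIdeal
  ... | inj₁ Rx⊆N = inj₁ (Rx⊆N (x∈principal x))
  ... | inj₂ N⊆Rx with proj₂ (proj₂ N-maximal) (principal x) (principal-isLeftIdeal x) N⊆Rx
  ...   | inj₁ Rx⊆N        = inj₁ (Rx⊆N (x∈principal x))
  ...   | inj₂ (y , 1≈yx) = inj₂ (y , sym 1≈yx)

  -- Nakayama: 1 - ρ ∉ N is invertible, and (1 - ρ) * z ≈ 0#.
  N-fixed⇒≈0 : ∀ {ρ z} → N ρ → z ≈ ρ * z → z ≈ 0#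
  N-fixed⇒≈0 {ρ} {z} ρ∈N z≈ρz with ∈N⊎leftInvertible (1# - ρ)
  ... | inj₁ 1-ρ∈N = contradiction (N-ideal.resp (//-rightDividesˡ ρ 1#) (N-ideal.add 1-ρ∈N ρ∈N)) 1∉N
  ... | inj₂ (w , w[1-ρ]≈1) = begin
    z                    ≈⟨ *-identityˡ z ⟨
    1# * z               ≈⟨ *-congʳ w[1-ρ]≈1 ⟨
    (w * (1# - ρ)) * z   ≈⟨ *-assoc w (1# - ρ) z ⟩
    w * ((1# - ρ) * z)   ≈⟨ *-congˡ ([y-z]x≈yx-zx z 1# ρ) ⟩
    w * (1# * z - ρ * z) ≈⟨ *-congˡ (+-cong (*-identityˡ z) (-‿cong (sym z≈ρz))) ⟩
    w * (z - z)          ≈⟨ *-congˡ (-‿inverseʳ z) ⟩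
    w * 0#               ≈⟨ zeroʳ w ⟩
    0#                   ∎

  leftInverse⇒rightInverse : ∀ {x y} → y * x ≈ 1# → x * y ≈ 1#
  leftInverse⇒rightInverse {x} {y} yx≈1 with ∈N⊎leftInvertible y
  ... | inj₂ (u , uy≈1) = trans (*-congʳ (sym u≈x)) uy≈1
    where
    u≈x : u ≈ x
    u≈x = begin
      u            ≈⟨ *-identityʳ u ⟨
      u * 1#       ≈⟨ *-congˡ yx≈1 ⟨
      u * (y * x)  ≈⟨ *-assoc u y x ⟨
      (u * y) * x  ≈⟨ *-congʳ uy≈1 ⟩
      1# * x       ≈⟨ *-identityˡ x ⟩
      x            ∎
  ... | inj₁ y∈N = contradiction 1≈0 (proj₁ chain)
    where
    xy≈0 : x * y ≈ 0#
    xy≈0 = N-fixed⇒≈0 (N-ideal.lmul x y∈N) (begin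
      x * y              ≈⟨ *-congˡ (*-identityˡ y) ⟨
      x * (1# * y)       ≈⟨ *-congˡ (*-congʳ yx≈1) ⟨
      x * ((y * x) * y)  ≈⟨ *-congˡ (*-assoc y x y) ⟩
      x * (y * (x * y))  ≈⟨ *-assoc x y (x * y) ⟨
      (x * y) * (x * y)  ∎)
    1≈0 : 1# ≈ 0#
    1≈0 = begin
      1#                 ≈⟨ yx≈1 ⟨
      y * x              ≈⟨ *-congʳ (*-identityˡ y) ⟨
      (1# * y) * x       ≈⟨ *-congʳ (*-congʳ yx≈1) ⟨
      ((y * x) * y) * x  ≈⟨ *-congʳ (*-assoc y x y) ⟩
      (y * (x * y)) * x  ≈⟨ *-congʳ (*-congˡ xy≈0) ⟩
      (y * 0#) * x       ≈⟨ *-congʳ (zeroʳ y) ⟩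
      0# * x             ≈⟨ zeroˡ x ⟩
      0#                 ∎

  N-*ʳ : ∀ {x} r → N x → N (x * r)
  N-*ʳ {x} r x∈N with ∈N⊎leftInvertible (x * r)
  ... | inj₁ xr∈N = xr∈N
  ... | inj₂ (y , y[xr]≈1) = contradiction (N-ideal.resp [ry]x≈1 (N-ideal.lmul (r * y) x∈N)) 1∉N
    where
    [ry]x≈1 : (r * y) * x ≈ 1#
    [ry]x≈1 = trans (*-assoc r y x) (leftInverse⇒rightInverse (trans (*-assoc y x r) y[xr]≈1))

  principal-cover : ∀ k (e : Fin k → Carrier) → Σ[ θ ∈ Carrier ] (N θ × (∀ j → N (e j) → principal θ (e j)))
  principal-cover zero e = 0# , N-ideal.zer , λ ()
  principal-cover (suc k) e with principal-cover k (e ∘ fsuc) | ∈N⊎leftInvertible (e fzero)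
  ... | θ , θ∈N , gen | inj₂ (y , ye₀≈1) =
    θ , θ∈N , λ { fzero e₀∈N → contradiction (N-ideal.resp ye₀≈1 (N-ideal.lmul y e₀∈N)) 1∉N
                ; (fsuc j) → gen j }
  ... | θ , θ∈N , gen | inj₁ e₀∈N with proj₂ chain (principal (e fzero)) (principal θ)
                                         (principal-isLeftIdeal _) (principal-isLeftIdeal _)
  ...   | inj₁ Re₀⊆Rθ = θ , θ∈N , λ { fzero _ → Re₀⊆Rθ (x∈principal _) ; (fsuc j) → gen j }
  ...   | inj₂ Rθ⊆Re₀ = e fzero , e₀∈N , λ { fzero _ → x∈principal _ ; (fsuc j) ej∈N → Rθ⊆Re₀ (gen j ej∈N) }

  N-principal : Finite → Σ[ θ ∈ Carrier ] (N θ × N ⊆ principal θ)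
  N-principal (k , e , e-onto) with principal-cover k e
  ... | θ , θ∈N , gen = θ , θ∈N , N⊆Rθ
    where
    N⊆Rθ : N ⊆ principal θ
    N⊆Rθ {x} x∈N with e-onto x
    ... | j , ej≈x = PHG.IsLeftIdeal.resp (principal-isLeftIdeal θ) ej≈x (gen j (N-ideal.resp (sym ej≈x) x∈N))

  module Uniformizer (θ : Carrier) (θ∈N : N θ) (N⊆Rθ : N ⊆ principal θ) where
    open SemiringExponentiation semiring using (_^_; ^-homo-*)

    θ^-normal : ∀ k r → Σ[ r' ∈ Carrier ] θ ^ k * r ≈ r' * θ ^ k
    θ^-normal zero r = r , trans (*-identityˡ r) (sym (*-identityʳ r))
    θ^-normal (suc k) r with θ^-normal k r
    ... | r₁ , θ^kr≈r₁θ^k with N⊆Rθ (N-*ʳ r₁ θ∈N)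
    ...   | r₂ , θr₁≈r₂θ = r₂ , (begin
      (θ * θ ^ k) * r   ≈⟨ *-assoc θ (θ ^ k) r ⟩
      θ * (θ ^ k * r)   ≈⟨ *-congˡ θ^kr≈r₁θ^k ⟩
      θ * (r₁ * θ ^ k)  ≈⟨ *-assoc θ r₁ (θ ^ k) ⟨
      (θ * r₁) * θ ^ k  ≈⟨ *-congʳ θr₁≈r₂θ ⟩
      (r₂ * θ) * θ ^ k  ≈⟨ *-assoc r₂ θ (θ ^ k) ⟩
      r₂ * (θ * θ ^ k)  ∎)

    θ^∈NPow : ∀ k → NPow k (θ ^ k)
    θ^∈NPow zero    = lift tt
    θ^∈NPow (suc k) = ac-gen (θ , θ ^ k , θ∈N , θ^∈NPow k , refl)

    principal-θ^⊆NPow : ∀ k → principal (θ ^ k) ⊆ NPow k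
    principal-θ^⊆NPow k (r , x≈rθ^k) = NPow-ideal.resp k (sym x≈rθ^k) (NPow-ideal.lmul k r (θ^∈NPow k))

    NPow⊆principal-θ^ : ∀ k → NPow k ⊆ principal (θ ^ k)
    NPow⊆principal-θ^ zero {x} _ = x , sym (*-identityʳ x)
    NPow⊆principal-θ^ (suc k) = generated
      where
      open IsLeftIdeal (principal-isLeftIdeal (θ ^ suc k))
      generated : NPow (suc k) ⊆ principal (θ ^ suc k)
      generated {x} (ac-gen (a , b , a∈N , b∈ , x≈ab)) with NPow⊆principal-θ^ k b∈
      ... | r , b≈rθ^k with N⊆Rθ (N-*ʳ r a∈N)
      ...   | t , ar≈tθ = t , (begin
        x                 ≈⟨ x≈ab ⟩
        a * b             ≈⟨ *-congˡ b≈rθ^k ⟩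
        a * (r * θ ^ k)   ≈⟨ *-assoc a r (θ ^ k) ⟨
        (a * r) * θ ^ k   ≈⟨ *-congʳ ar≈tθ ⟩
        (t * θ) * θ ^ k   ≈⟨ *-assoc t θ (θ ^ k) ⟩
        t * (θ * θ ^ k)   ∎)
      generated (ac-zer x≈0)         = resp (sym x≈0) zer
      generated (ac-add y∈ z∈ x≈y+z) = resp (sym x≈y+z) (add (generated y∈) (generated z∈))

    NPow-*ʳ : ∀ k r {x} → NPow k x → NPow k (x * r)
    NPow-*ʳ k r {x} x∈ with NPow⊆principal-θ^ k x∈ | θ^-normal k r
    ... | t , x≈tθ^k | r' , θ^kr≈r'θ^k = principal-θ^⊆NPow k (t * r' , (begin
      x * r              ≈⟨ *-congʳ x≈tθ^k ⟩
      (t * θ ^ k) * r    ≈⟨ *-assoc t (θ ^ k) r ⟩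
      t * (θ ^ k * r)    ≈⟨ *-congˡ θ^kr≈r'θ^k ⟩
      t * (r' * θ ^ k)   ≈⟨ *-assoc t r' (θ ^ k) ⟨
      (t * r') * θ ^ k   ∎))

    θ^-*-NPow : ∀ s a {x} → NPow (a ∸ s) x → NPow a (θ ^ s * x)
    θ^-*-NPow s a {x} x∈ with NPow⊆principal-θ^ (a ∸ s) x∈
    ... | r , x≈rθ^[a∸s] with θ^-normal s r
    ...   | r' , θ^sr≈r'θ^s =
      NPow-antitone (ℕₚ.m≤n+m∸n a s) (principal-θ^⊆NPow (s ℕ.+ (a ∸ s)) (r' , (begin
        θ ^ s * x                   ≈⟨ *-congˡ x≈rθ^[a∸s] ⟩
        θ ^ s * (r * θ ^ (a ∸ s))   ≈⟨ *-assoc (θ ^ s) r (θ ^ (a ∸ s)) ⟨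
        (θ ^ s * r) * θ ^ (a ∸ s)   ≈⟨ *-congʳ θ^sr≈r'θ^s ⟩
        (r' * θ ^ s) * θ ^ (a ∸ s)  ≈⟨ *-assoc r' (θ ^ s) (θ ^ (a ∸ s)) ⟩
        r' * (θ ^ s * θ ^ (a ∸ s))  ≈⟨ *-congˡ (^-homo-* θ s (a ∸ s)) ⟨
        r' * θ ^ (s ℕ.+ (a ∸ s))    ∎)))

    θ^-*-≡[] : ∀ s a {x y} → x ≡[ a ∸ s ] y → (θ ^ s * x) ≡[ a ] (θ ^ s * y)
    θ^-*-≡[] s a x≡y = NPow-ideal.resp a (x[y-z]≈xy-xz (θ ^ s) _ _) (θ^-*-NPow s a x≡y)

    NPow⊎invertible*θ^ : ∀ d y →
      NPow d y ⊎ Σ[ k ∈ ℕ ] (k < d × Σ[ u ∈ Carrier ] (LeftInvertible u × y ≈ u * θ ^ k))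
    NPow⊎invertible*θ^ zero    y = inj₁ (lift tt)
    NPow⊎invertible*θ^ (suc d) y with NPow⊎invertible*θ^ d y
    ... | inj₂ (k , k<d , u-data) = inj₂ (k , ℕₚ.m<n⇒m<1+n k<d , u-data)
    ... | inj₁ y∈ with NPow⊆principal-θ^ d y∈
    ...   | r , y≈rθ^d with ∈N⊎leftInvertible r
    ...     | inj₂ r-invertible = inj₂ (d , ℕₚ.n<1+n d , r , r-invertible , y≈rθ^d)
    ...     | inj₁ r∈N with N⊆Rθ r∈N
    ...       | t , r≈tθ =
      inj₁ (principal-θ^⊆NPow (suc d) (t , trans y≈rθ^d (trans (*-congʳ r≈tθ) (*-assoc t θ (θ ^ d)))))

    module Nilpotent (m : ℕ) (NPow≢0 : ∀ k → k < m → ¬ IsZeroIdeal (NPow k)) where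

      θ^∉NPow-suc : ∀ {j} → j < m → ¬ NPow (suc j) (θ ^ j)
      θ^∉NPow-suc {j} j<m θ^j∈ with NPow⊆principal-θ^ (suc j) θ^j∈
      ... | r , θ^j≈r[θθ^j] = NPow≢0 j j<m N^j≈0
        where
        θ^j≈0 : θ ^ j ≈ 0#
        θ^j≈0 = N-fixed⇒≈0 (N-ideal.lmul r θ∈N) (trans θ^j≈r[θθ^j] (sym (*-assoc r θ (θ ^ j))))
        N^j≈0 : IsZeroIdeal (NPow j)
        N^j≈0 x x∈ with NPow⊆principal-θ^ j x∈
        ... | t , x≈tθ^j = trans x≈tθ^j (trans (*-congˡ θ^j≈0) (zeroʳ t))

      θ^-conjugate-invertible : ∀ {s u u'} → s < m → LeftInvertible u →
                                θ ^ s * u ≈ u' * θ ^ s → LeftInvertible u'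
      θ^-conjugate-invertible {s} {u} {u'} s<m (w , wu≈1) θ^su≈u'θ^s with ∈N⊎leftInvertible u'
      ... | inj₂ u'-invertible = u'-invertible
      ... | inj₁ u'∈N = contradiction θ^s∈ (θ^∉NPow-suc s<m)
        where
        θ^s≈u'θ^sw : θ ^ s ≈ (u' * θ ^ s) * w
        θ^s≈u'θ^sw = begin
          θ ^ s               ≈⟨ *-identityʳ (θ ^ s) ⟨
          θ ^ s * 1#          ≈⟨ *-congˡ (leftInverse⇒rightInverse wu≈1) ⟨
          θ ^ s * (u * w)     ≈⟨ *-assoc (θ ^ s) u w ⟨
          (θ ^ s * u) * w     ≈⟨ *-congʳ θ^su≈u'θ^s ⟩
          (u' * θ ^ s) * w    ∎
        θ^s∈ : NPow (suc s) (θ ^ s)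
        θ^s∈ = NPow-ideal.resp (suc s) (sym θ^s≈u'θ^sw)
                 (NPow-*ʳ (suc s) w (ac-gen (u' , θ ^ s , u'∈N , θ^∈NPow s , refl)))

      θ^-cancel : ∀ s a {y} → a ≤ m → NPow a (θ ^ s * y) → NPow (a ∸ s) y
      θ^-cancel s a {y} a≤m θ^sy∈ with NPow⊎invertible*θ^ (a ∸ s) y
      ... | inj₁ y∈ = y∈
      ... | inj₂ (k , k<a∸s , u , u-invertible , y≈uθ^k) with θ^-normal s u
      ...   | u' , θ^su≈u'θ^s with θ^-conjugate-invertible s<m u-invertible θ^su≈u'θ^s
        where
        s<m : s < m
        s<m = ℕₚ.≤-trans (ℕₚ.m+n≤o⇒m≤o (suc s) (m<n∸o⇒o+m<n s k<a∸s)) a≤m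
      ...     | v , vu'≈1 =
        contradiction (NPow-antitone s+k<a (NPow-ideal.resp a (sym θ^[s+k]≈vθ^sy) (NPow-ideal.lmul a v θ^sy∈)))
                      (θ^∉NPow-suc (ℕₚ.<-≤-trans s+k<a a≤m))
        where
        s+k<a : s ℕ.+ k < a
        s+k<a = m<n∸o⇒o+m<n s k<a∸s
        θ^[s+k]≈vθ^sy : θ ^ (s ℕ.+ k) ≈ v * (θ ^ s * y)
        θ^[s+k]≈vθ^sy = begin
          θ ^ (s ℕ.+ k)                ≈⟨ ^-homo-* θ s k ⟩
          θ ^ s * θ ^ k                ≈⟨ *-identityˡ (θ ^ s * θ ^ k) ⟨
          1# * (θ ^ s * θ ^ k)         ≈⟨ *-congʳ vu'≈1 ⟨
          (v * u') * (θ ^ s * θ ^ k)   ≈⟨ *-assoc v u' (θ ^ s * θ ^ k) ⟩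
          v * (u' * (θ ^ s * θ ^ k))   ≈⟨ *-congˡ (*-assoc u' (θ ^ s) (θ ^ k)) ⟨
          v * ((u' * θ ^ s) * θ ^ k)   ≈⟨ *-congˡ (*-congʳ θ^su≈u'θ^s) ⟨
          v * ((θ ^ s * u) * θ ^ k)    ≈⟨ *-congˡ (*-assoc (θ ^ s) u (θ ^ k)) ⟩
          v * (θ ^ s * (u * θ ^ k))    ≈⟨ *-congˡ (*-congˡ y≈uθ^k) ⟨
          v * (θ ^ s * y)              ∎

      θ^-*-≡[]⁻¹ : ∀ s a {x y} → a ≤ m → (θ ^ s * x) ≡[ a ] (θ ^ s * y) → x ≡[ a ∸ s ] y
      θ^-*-≡[]⁻¹ s a a≤m θ^sx≡θ^sy =
        θ^-cancel s a a≤m (NPow-ideal.resp a (sym (x[y-z]≈xy-xz (θ ^ s) _ _)) θ^sx≡θ^sy)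

      module Lowering {k : ℕ} (k≤m : k ≤ m) (s : ℕ) {n : ℕ} {U : Pred (Vector Carrier n) (c ⊔ ℓ)}
                      {ls : List ℕ} (bounded : All (λ l → 1 ≤ l × l ≤ k) ls)
                      {f : Model ls → Vector Carrier n} (iso : IsIsoAt k ls U f) where
        private module Iso = IsIsoAt iso

        LoweredEq : Model ls → Model ls → Set (c ⊔ ℓ)
        LoweredEq x y = ∀ j → x j ≡[ lookup ls j ∸ s ] y j

        LoweredEq⇒f-≡ : ∀ x y → LoweredEq x y → f x ≡ᵥ[ k ∸ s ] f y
        LoweredEq⇒f-≡ x y x≡y t = θ^-*-≡[]⁻¹ s k k≤m (θ^sfx≡θ^sfy t)
          where
          θ^sfx≡θ^sfy : ((θ ^ s) ·ᵥ f x) ≡ᵥ[ k ] ((θ ^ s) ·ᵥ f y)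
          θ^sfx≡θ^sfy = ≡ᵥ.trans k (≡ᵥ.sym k (Iso.smul (θ ^ s) x))
                          (≡ᵥ.trans k (Iso.resp _ _ (λ j → θ^-*-≡[] s (lookup ls j) (x≡y j)))
                                      (Iso.smul (θ ^ s) y))

        f-≡⇒LoweredEq : ∀ x y → f x ≡ᵥ[ k ∸ s ] f y → LoweredEq x y
        f-≡⇒LoweredEq x y fx≡fy j = θ^-*-≡[]⁻¹ s (lookup ls j) λⱼ≤m (Iso.inj _ _ fθ^sx≡fθ^sy j)
          where
          λⱼ≤m : lookup ls j ≤ m
          λⱼ≤m = ℕₚ.≤-trans (proj₂ (All.lookup bounded (∈-lookup j))) k≤m
          fθ^sx≡fθ^sy : f (λ j → θ ^ s * x j) ≡ᵥ[ k ] f (λ j → θ ^ s * y j)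
          fθ^sx≡fθ^sy = ≡ᵥ.trans k (Iso.smul (θ ^ s) x)
                          (≡ᵥ.trans k (λ t → θ^-*-≡[] s k (fx≡fy t)) (≡ᵥ.sym k (Iso.smul (θ ^ s) y)))

        ≡-at-dropped : ∀ {l} x y → l ≤ s → x ≡[ l ∸ s ] y
        ≡-at-dropped x y l≤s = ≡.subst (λ a → NPow a (x - y)) (≡.sym (ℕₚ.m≤n⇒m∸n≡0 l≤s)) (lift tt)

        lower : ∀ {v w : Vector Carrier n} → v ≡ᵥ[ k ] w → v ≡ᵥ[ k ∸ s ] w
        lower = ≡ᵥ[]-antitone (ℕₚ.m∸n≤m k s)

        f-resp-≈ : ∀ x y → (∀ j → x j ≈ y j) → f x ≡ᵥ[ k ∸ s ] f y
        f-resp-≈ x y x≈y = lower (Iso.resp x y (λ j → ≈⇒≡[] (lookup ls j) (x≈y j)))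

        pad₀ : Model (lowerParts s ls) → Model ls
        pad₀ = pad 0# s ls

        isIsoAt-lowered : IsIsoAt (k ∸ s) (lowerParts s ls) U (f ∘ pad₀)
        isIsoAt-lowered = record
          { resp = λ x y x≡y → LoweredEq⇒f-≡ (pad₀ x) (pad₀ y) (pad-LoweredEq x≡y)
          ; into = λ x → Iso.into (pad₀ x)
          ; add  = λ x y → ≡ᵥ.trans (k ∸ s) (f-resp-≈ _ _ (pad-+ x y)) (lower (Iso.add (pad₀ x) (pad₀ y)))
          ; smul = λ r x → ≡ᵥ.trans (k ∸ s) (f-resp-≈ _ _ (pad-* r x)) (lower (Iso.smul r (pad₀ x)))
          ; inj  = inj
          ; surj = surj
          }
          where
          pad-LoweredEq : ∀ {x y} → ModelEq (lowerParts s ls) x y → LoweredEq (pad₀ x) (pad₀ y)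
          pad-LoweredEq {x} {y} x≡y j with dropped⊎survives 0# s ls j
          ... | inj₁ (l≤s , _) = ≡-at-dropped _ _ l≤s
          ... | inj₂ (j' , l≡ , pad≡ , _) rewrite pad≡ x | pad≡ y = ≡.subst (λ a → NPow a _) l≡ (x≡y j')

          pad-+ : ∀ x y j → pad₀ (λ j → x j + y j) j ≈ pad₀ x j + pad₀ y j
          pad-+ x y j with dropped⊎survives 0# s ls j
          ... | inj₁ (_ , pad≡0) rewrite pad≡0 (λ j → x j + y j) | pad≡0 x | pad≡0 y = sym (+-identityʳ 0#)
          ... | inj₂ (_ , _ , pad≡ , _) rewrite pad≡ (λ j → x j + y j) | pad≡ x | pad≡ y = refl

          pad-* : ∀ r x j → pad₀ (λ j → r * x j) j ≈ r * pad₀ x j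
          pad-* r x j with dropped⊎survives 0# s ls j
          ... | inj₁ (_ , pad≡0) rewrite pad≡0 (λ j → r * x j) | pad≡0 x = sym (zeroʳ r)
          ... | inj₂ (_ , _ , pad≡ , _) rewrite pad≡ (λ j → r * x j) | pad≡ x = refl

          inj : ∀ x y → f (pad₀ x) ≡ᵥ[ k ∸ s ] f (pad₀ y) → ModelEq (lowerParts s ls) x y
          inj x y fx≡fy j' with origin 0# s ls j'
          ... | j , l≡ , pad≡ with f-≡⇒LoweredEq (pad₀ x) (pad₀ y) fx≡fy j
          ...   | xⱼ≡yⱼ rewrite pad≡ x | pad≡ y = ≡.subst (λ a → NPow a _) (≡.sym l≡) xⱼ≡yⱼ

          surj : ∀ v → U v → Σ[ x ∈ Model (lowerParts s ls) ] (f (pad₀ x) ≡ᵥ[ k ∸ s ] v)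
          surj v v∈U with Iso.surj v v∈U
          ... | x , fx≡v = restrict 0# s ls x , ≡ᵥ.trans (k ∸ s) (LoweredEq⇒f-≡ _ _ pad-restrict) (lower fx≡v)
            where
            pad-restrict : LoweredEq (pad₀ (restrict 0# s ls x)) x
            pad-restrict j with dropped⊎survives 0# s ls j
            ... | inj₁ (l≤s , _) = ≡-at-dropped _ _ l≤s
            ... | inj₂ (_ , _ , pad≡ , restrict≡) rewrite pad≡ (restrict 0# s ls x) | restrict≡ x =
              ≈⇒≡[] _ refl

      module Reduction {i k : ℕ} (i≤k : i ≤ k) (k≤m : k ≤ m) {n : ℕ} where

        HasPartsAt-lower : ∀ {U : Pred (Vector Carrier n) (c ⊔ ℓ)} {ls} →
                           HasPartsAt k U ls → HasPartsAt i U (lowerParts (k ∸ i) ls)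
        HasPartsAt-lower {U} {ls} (bounded , f , iso) =
          ≡.subst (λ j → HasPartsAt j U (lowerParts (k ∸ i) ls)) (ℕₚ.m∸[m∸n]≡n i≤k)
            (lowerParts-bounded (k ∸ i) _ bounded , _ , Lowering.isIsoAt-lowered k≤m (k ∸ i) bounded iso)

        HasShapeAt-lower : ∀ {U : Pred (Vector Carrier n) (c ⊔ ℓ)} {a} →
                           HasShapeAt k U a → HasShapeAt i U (λ j → a (k ∸ i ℕ.+ j))
        HasShapeAt-lower (ls , parts , counts) =
          lowerParts (k ∸ i) ls , HasPartsAt-lower parts , λ j 1≤j j≤i →
            ≡.trans (countPart-lowerParts (k ∸ i) ls 1≤j)
                    (counts _ (ℕₚ.≤-trans 1≤j (ℕₚ.m≤n+m j (k ∸ i)))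
                              (ℕₚ.≤-trans (ℕₚ.+-monoʳ-≤ (k ∸ i) j≤i) (ℕₚ.≤-reflexive (ℕₚ.m∸n+n≡m i≤k))))

        ContainsPointAt-lower : ∀ {U : Pred (Vector Carrier n) (c ⊔ ℓ)} → 1 ≤ i →
                                ContainsPointAt k U → ContainsPointAt i U
        ContainsPointAt-lower 1≤i (P , P-submodule , P-point , P⊆U) =
          P , P-submodule ,
          ≡.subst (HasPartsAt i P) (lowerParts-singleton 1≤i i≤k) (HasPartsAt-lower P-point) ,
          SubsetAt-antitone i≤k P⊆U

        IsSubspaceOfShapeAt-lower : ∀ {U : Pred (Vector Carrier n) (c ⊔ ℓ)} {a} → 1 ≤ i →
                                    IsSubspaceOfShapeAt k U a → IsSubspaceOfShapeAt i U (λ j → a (k ∸ i ℕ.+ j))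
        IsSubspaceOfShapeAt-lower 1≤i (shape , point) = HasShapeAt-lower shape , ContainsPointAt-lower 1≤i point

        MeetsInShapeAt-lower : ∀ {U V : Pred (Vector Carrier n) (c ⊔ ℓ)} {τ} → 1 ≤ i →
                               MeetsInShapeAt k τ U V → MeetsInShapeAt i (λ j → τ (k ∸ i ℕ.+ j)) U V
        MeetsInShapeAt-lower 1≤i (W , W-submodule , W-subspace , W⊆U , W⊆V) =
          W , W-submodule , IsSubspaceOfShapeAt-lower 1≤i W-subspace ,
          SubsetAt-antitone i≤k W⊆U , SubsetAt-antitone i≤k W⊆V

open import Data.Nat using (_+_)

lemma3p1 : ∀ {c ℓ : Level} (R : Ring c ℓ) → let open Ring R using (Carrier) in let open PHG R in
    Finite → IsChainRing →
    (N : Pred Carrier (c ⊔ ℓ)) → IsMaximalLeftIdeal N →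
    let open WithN N in
    (m : ℕ) → NilpotencyIndex m →
    (n : ℕ) → 3 ≤ n →
    (κ τ : ℕ → ℕ) (M : ℕ) (F : Fin M → Pred (Vector Carrier n) (c ⊔ ℓ)) →
    (∀ a → IsSubmodule (F a)) →
    (∀ a → IsSubspaceOfShapeAt m (F a) κ) →
    IsIntersectingAt m τ F →
    (i : ℕ) → 1 ≤ i → i < m →
    (∀ a → IsSubspaceOfShapeAt i (η i (F a)) (λ j → κ (m ∸ i + j)))
    × IsIntersectingAt i (λ j → τ (m ∸ i + j)) (λ a → η i (F a))
lemma3p1 R finite chain N N-maximal m (_ , NPow≢0) n _ κ τ M F _ F-shape F-meet i 1≤i i<m
  with ChainRing.N-principal R chain N N-maximal finite
... | θ , θ∈N , N⊆Rθ =
  (λ a → IsSubspaceOfShapeAt-η (IsSubspaceOfShapeAt-lower 1≤i (F-shape a))) ,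
  λ a b η-distinct → MeetsInShapeAt-η (MeetsInShapeAt-lower 1≤i (F-meet a b (η-distinct ∘ SameAt⇒η-SameAt i≤m)))
  where
  open ChainRing R chain N N-maximal
  open Uniformizer θ θ∈N N⊆Rθ
  open Nilpotent m NPow≢0
  i≤m : i ≤ m
  i≤m = ℕₚ.<⇒≤ i<m
  open Reduction i≤m ℕₚ.≤-refl
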